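{- Let $D$ be a digraph of order $n$, $2\le k\le n$ and $\ell\ge 1$. (a) $D$ is minimally generalized $(k,\ell)$-vertex-strongly connected if and only if $\kappa_k(D)=\ell$ and $\kappa_k(D-e)=\ell-1$ for every arc $e\in A(D)$. (b) $D$ is minimally generalized $(k,\ell)$-arc-strongly connected if and only if $\lambda_k(D)=\ell$ and $\lambda_k(D-e)=\ell-1$ for every arc $e\in A(D)$.
   Context: Digraphs have no loops or parallel arcs. An out-tree is an oriented tree in which every vertex except the root has in-degree one. For $S\subseteq V(D)$, $|S|\ge 2$, $r\in S$, an $(S,r)$-tree is an out-tree in $D$ rooted at $r$ whose vertex set contains $S$. Two $(S,r)$-trees are arc-disjoint if they share no arc, and internally disjoint if moreover their vertex sets intersect exactly in $S$. $\kappa_{S,r}(D)$ (resp. $\lambda_{S,r}(D)$) is the maximum number of pairwise internally disjoint (resp. arc-disjoint) $(S,r)$-trees; $\kappa_k(D)$ (resp. $\lambda_k(D)$) is the minimum of $\kappa_{S,r}(D)$ (resp. $\lambda_{S,r}(D)$) over all $S\subseteq V(D)$ with $|S|=k$ and all $r\in S$. $D$ is minimally generalized $(k,\ell)$-vertex-strongly (resp. arc-strongly) connected if $\kappa_k(D)\ge\ell$ (resp. $\lambda_k(D)\ge\ell$) but $\kappa_k(D-e)\le\ell-1$ (resp. $\lambda_k(D-e)\le\ell-1$) for every arc $e$. -}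

module Defs where

open import Data.Nat using (ℕ; zero; suc; _≤_; _∸_)
open import Data.Bool using (Bool; true; false; _∧_; not)
open import Data.Fin using (Fin; _≟_)
open import Data.Fin.Subset using (Subset; _∈_; _⊆_; ∣_∣)
open import Data.Vec using (tabulate)
open import Data.List using (map; allFin)
open import Data.Nat.ListAction using (sum)
open import Data.Product using (Σ; ∃; _×_; _,_)
open import Relation.Binary.PropositionalEquality using (_≡_; _≢_; refl)
open import Data.Empty using (⊥)
open import Relation.Nullary.Decidable using (⌊_⌋)

-- A digraph of order n on vertex set Fin n: adjacency relation, no loops.
-- (Parallel arcs are impossible in this representation.)
record Digraph (n : ℕ) : Set where
  field
    adj      : Fin n → Fin n → Bool
    loopless : ∀ v → adj v v ≡ false
open Digraph public

IsArc : ∀ {n} → Digraph n → Fin n → Fin n → Set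
IsArc D u v = adj D u v ≡ true

removeAdj : ∀ {n} → (Fin n → Fin n → Bool) → Fin n → Fin n → Fin n → Fin n → Bool
removeAdj a u v x y = a x y ∧ not (⌊ x ≟ u ⌋ ∧ ⌊ y ≟ v ⌋)

removeAdj-loopless : ∀ {n} (D : Digraph n) u v x → removeAdj (adj D) u v x x ≡ false
removeAdj-loopless D u v x rewrite loopless D x = refl

_-arc_ : ∀ {n} → Digraph n → Fin n × Fin n → Digraph n
D -arc (u , v) = record { adj = removeAdj (adj D) u v ; loopless = removeAdj-loopless D u v }

count : ∀ {n} → (Fin n → Bool) → ℕ
count p = ∣ tabulate p ∣

arcCount : ∀ {n} → (Fin n → Fin n → Bool) → ℕ
arcCount {n} A = sum (map (λ u → count (A u)) (allFin n))

data UConn {n} (A : Fin n → Fin n → Bool) : Fin n → Fin n → Set where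
  here : ∀ {x} → UConn A x x
  fwd  : ∀ {x y z} → A x y ≡ true → UConn A y z → UConn A x z
  bwd  : ∀ {x y z} → A y x ≡ true → UConn A y z → UConn A x z

record Sub {n} (D : Digraph n) : Set where
  field
    V : Subset n
    A : Fin n → Fin n → Bool
    A⊆D   : ∀ x y → A x y ≡ true → adj D x y ≡ true
    A-tail : ∀ x y → A x y ≡ true → x ∈ V
    A-head : ∀ x y → A x y ≡ true → y ∈ V
open Sub public

-- H is an oriented tree: its underlying graph is a tree, i.e. connected
-- with |A(H)| = |V(H)| - 1 (arcs counted as ordered pairs, so this also
-- rules out pairs of opposite arcs).
IsOrientedTree : ∀ {n} {D : Digraph n} → Sub D → Set
IsOrientedTree H =
  (∀ x y → x ∈ V H → y ∈ V H → UConn (A H) x y) ×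
  (arcCount (A H) ≡ ∣ V H ∣ ∸ 1)

IsOutTree : ∀ {n} {D : Digraph n} → Sub D → Fin n → Set
IsOutTree H r =
  r ∈ V H × IsOrientedTree H ×
  (∀ v → v ∈ V H → v ≢ r → count (λ u → A H u v) ≡ 1)

IsSrTree : ∀ {n} {D : Digraph n} → Subset n → Fin n → Sub D → Set
IsSrTree S r H = IsOutTree H r × S ⊆ V H

ArcDisjoint : ∀ {n} {D : Digraph n} → Sub D → Sub D → Set
ArcDisjoint H H' = ∀ x y → A H x y ≡ true → A H' x y ≡ true → ⊥

InternallyDisjoint : ∀ {n} {D : Digraph n} → Subset n → Sub D → Sub D → Set
InternallyDisjoint S H H' = ArcDisjoint H H' × (∀ x → x ∈ V H → x ∈ V H' → x ∈ S)

Rel : ∀ {n} → Digraph n → Set₁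
Rel {n} D = Subset n → Sub D → Sub D → Set

Family : ∀ {n} (D : Digraph n) → Rel D → Subset n → Fin n → ℕ → Set
Family D R S r m =
  Σ (Fin m → Sub D) λ T →
    (∀ i → IsSrTree S r (T i)) × (∀ i j → i ≢ j → R S (T i) (T j))

IsMaxFamily : ∀ {n} (D : Digraph n) → Rel D → Subset n → Fin n → ℕ → Set
IsMaxFamily D R S r m = Family D R S r m × (∀ m' → Family D R S r m' → m' ≤ m)

IsMinMax : ∀ {n} (D : Digraph n) → Rel D → ℕ → ℕ → Set
IsMinMax {n} D R k m =
  (Σ (Subset n) λ S → Σ (Fin n) λ r → ∣ S ∣ ≡ k × r ∈ S × IsMaxFamily D R S r m) ×
  (∀ (S : Subset n) (r : Fin n) → ∣ S ∣ ≡ k → r ∈ S →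
     ∀ m' → IsMaxFamily D R S r m' → m ≤ m')

KappaIs : ∀ {n} → Digraph n → ℕ → ℕ → Set
KappaIs D k m = IsMinMax D InternallyDisjoint k m

LambdaIs : ∀ {n} → Digraph n → ℕ → ℕ → Set
LambdaIs D k m = IsMinMax D (λ _ → ArcDisjoint) k m

KappaGE KappaLE LambdaGE LambdaLE : ∀ {n} → Digraph n → ℕ → ℕ → Set
KappaGE D k ℓ = ∃ λ m → KappaIs D k m × ℓ ≤ m
KappaLE D k ℓ = ∃ λ m → KappaIs D k m × m ≤ ℓ
LambdaGE D k ℓ = ∃ λ m → LambdaIs D k m × ℓ ≤ m
LambdaLE D k ℓ = ∃ λ m → LambdaIs D k m × m ≤ ℓ

MinVertexStrong : ∀ {n} → Digraph n → ℕ → ℕ → Set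
MinVertexStrong {n} D k ℓ =
  KappaGE D k ℓ ×
  (∀ (u v : Fin n) → IsArc D u v → KappaLE (D -arc (u , v)) k (ℓ ∸ 1))

MinArcStrong : ∀ {n} → Digraph n → ℕ → ℕ → Set
MinArcStrong {n} D k ℓ =
  LambdaGE D k ℓ ×
  (∀ (u v : Fin n) → IsArc D u v → LambdaLE (D -arc (u , v)) k (ℓ ∸ 1))

-- Deleting an arc e destroys at most one tree of any family of pairwise
-- arc-disjoint (S , r)-trees, and trees of D - e are trees of D; hence κ_k(D - e) ∈ {κ_k(D) - 1, κ_k(D)}, and likewise for λ_k.
-- If κ_k(D) ≥ ℓ ≥ 1 then D has an arc, since an (S , r)-tree must reach the
-- vertices of S other than r; so κ_k(D) ≥ ℓ together with κ_k(D - e) ≤ ℓ - 1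
-- for all arcs e pins down κ_k(D) = ℓ and κ_k(D - e) = ℓ - 1.
module Submission where

open import Defs
open import Data.Nat using (ℕ; _≤_; _∸_)
open import Data.Fin using (Fin)
open import Data.Product using (_×_; _,_)
open import Function.Bundles using (_⇔_)

open import Data.Nat using (zero; suc; z≤n; s≤s)
open import Data.Nat.Properties
  using (≤-trans; ≤-antisym; m+[n∸m]≡n; ≤-refl; ≤-pred; n≤1+n; ≤∧≢⇒<; _≤?_)
open import Data.Fin using (punchIn) renaming (zero to fzero; _≟_ to _≟ᶠ_)
open import Data.Fin.Properties using (any?; punchIn-injective; punchInᵢ≢i)
open import Data.Fin.Subset using (Subset; _∈_; _⊆_; ∣_∣; ⁅_⁆)
open import Data.Fin.Subset.Properties using (_∈?_; ∣⁅x⁆∣≡1; p⊆q⇒∣p∣≤∣q∣; x∈⁅y⁆⇔x≡y)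
open import Data.Bool using (Bool; true; false; _∧_)
import Data.Bool as Bool
open import Data.Product using (Σ; ∃; proj₁; proj₂)
open import Data.Empty using (⊥; ⊥-elim)
open import Relation.Nullary using (¬_; Dec; yes; no; ¬?)
open import Relation.Nullary.Decidable.Core using (¬¬-excluded-middle; decidable-stable; _×-dec_)
open import Relation.Binary.PropositionalEquality using (_≡_; _≢_; refl; sym; subst)
open import Function.Bundles using (mk⇔; Equivalence)

Arcs : ℕ → Set
Arcs n = Fin n → Fin n → Bool

-- A disjointness notion for subdigraphs that only inspects their vertex and arc
-- sets, so that the same notion makes sense in D and in D - e.
Disjointness : ℕ → Set₁
Disjointness n = Subset n → Subset n × Arcs n → Subset n × Arcs n → Set

onSub : ∀ {n} (D : Digraph n) → Disjointness n → Rel D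
onSub D Q S H H' = Q S (V H , A H) (V H' , A H')

ImpliesArcDisjoint : ∀ {n} → Disjointness n → Set
ImpliesArcDisjoint Q =
  ∀ {S a b} → Q S a b → ∀ x y → proj₂ a x y ≡ true → proj₂ b x y ≡ true → ⊥

∧-true : ∀ {a b} → a ∧ b ≡ true → a ≡ true
∧-true {true} _ = refl

≢true⇒≡false : ∀ {a} → a ≢ true → a ≡ false
≢true⇒≡false {true}  a≢true = ⊥-elim (a≢true refl)
≢true⇒≡false {false} _      = refl

module RemoveArc {n} (D : Digraph n) (u v : Fin n) where

  D-e : Digraph n
  D-e = D -arc (u , v)

  Sub-lift : (T : Sub D) → A T u v ≡ false → Sub D-e
  Sub-lift T uv∉T = record
    { V = V T ; A = A T ; A⊆D = A⊆D-e ; A-tail = A-tail T ; A-head = A-head T }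
    where
    A⊆D-e : ∀ x y → A T x y ≡ true → removeAdj (adj D) u v x y ≡ true
    A⊆D-e x y xy∈T with x ≟ᶠ u | y ≟ᶠ v | A⊆D T x y xy∈T
    ... | yes refl | yes refl | _ with subst (_≡ true) uv∉T xy∈T
    ...   | ()
    A⊆D-e x y xy∈T | yes _ | no _  | xy∈D rewrite xy∈D = refl
    A⊆D-e x y xy∈T | no _  | _     | xy∈D rewrite xy∈D = refl

  Sub-unlift : Sub D-e → Sub D
  Sub-unlift T = record
    { V = V T ; A = A T ; A⊆D = λ x y xy∈T → ∧-true (A⊆D T x y xy∈T)
    ; A-tail = A-tail T ; A-head = A-head T }

  module _ (Q : Disjointness n) (Q⇒arcDisjoint : ImpliesArcDisjoint Q) where

    Family-unlift : ∀ {S r t} → Family D-e (onSub D-e Q) S r t → Family D (onSub D Q) S r t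
    Family-unlift (T , trees , disjoint) = (λ i → Sub-unlift (T i)) , trees , disjoint

    -- Arc-disjointness leaves at most one tree containing u → v; drop that one.
    Family-removeArc : ∀ {S r t} →
      Family D (onSub D Q) S r (suc t) → Family D-e (onSub D-e Q) S r t
    Family-removeArc {S} {r} {t} (T , trees , disjoint) =
      dropIndex (allButOneAvoid (any? (λ i → A (T i) u v Bool.≟ true)))
      where
      AllButOneAvoid : Set
      AllButOneAvoid = Σ (Fin (suc t)) λ i → ∀ j → j ≢ i → A (T j) u v ≡ false

      allButOneAvoid : Dec (∃ λ i → A (T i) u v ≡ true) → AllButOneAvoid
      allButOneAvoid (yes (i , uv∈Tᵢ)) = i , λ j j≢i →
        ≢true⇒≡false λ uv∈Tⱼ → Q⇒arcDisjoint (disjoint j i j≢i) u v uv∈Tⱼ uv∈Tᵢ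
      allButOneAvoid (no none) = fzero , λ j _ → ≢true⇒≡false λ uv∈Tⱼ → none (j , uv∈Tⱼ)

      dropIndex : AllButOneAvoid → Family D-e (onSub D-e Q) S r t
      dropIndex (i , avoid) =
          (λ k → Sub-lift (T (punchIn i k)) (avoid (punchIn i k) (punchInᵢ≢i i k)))
        , (λ k → trees (punchIn i k))
        , λ k l k≢l → disjoint (punchIn i k) (punchIn i l) (λ eq → k≢l (punchIn-injective i k l eq))

    Family-bound : ∀ {S r m} → IsMaxFamily D-e (onSub D-e Q) S r m →
      ∀ t → Family D (onSub D Q) S r t → t ≤ suc m
    Family-bound max zero    _ = z≤n
    Family-bound max (suc t) F = s≤s (proj₂ max t (Family-removeArc F))

    -- Whether κ_{S,r}(D) is m or m + 1 is not decidable, hence the double negation.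
    IsMaxFamily-removeArc : ∀ {S r m} → IsMaxFamily D-e (onSub D-e Q) S r m →
      ¬ ¬ (∃ λ m' → IsMaxFamily D (onSub D Q) S r m' × m' ≤ suc m)
    IsMaxFamily-removeArc {S} {r} {m} max ¬max =
      ¬¬-excluded-middle λ
        { (yes F) → ¬max (suc m , (F , Family-bound max) , ≤-refl)
        ; (no ¬F) → ¬max (m , (Family-unlift (proj₁ max) , bound ¬F) , n≤1+n m) }
      where
      bound : ¬ Family D (onSub D Q) S r (suc m) → ∀ t → Family D (onSub D Q) S r t → t ≤ m
      bound ¬F t F = ≤-pred (≤∧≢⇒< (Family-bound max t F) λ { refl → ¬F F })

    IsMinMax-removeArc : ∀ {k m m'} →
      IsMinMax D (onSub D Q) k m → IsMinMax D-e (onSub D-e Q) k m' → m ≤ suc m'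
    IsMinMax-removeArc {m = m} {m'} (_ , minimal) ((S , r , ∣S∣≡k , r∈S , max) , _) =
      decidable-stable (m ≤? suc m') λ m≰ →
        IsMaxFamily-removeArc max λ (m'' , max'' , m''≤) →
          m≰ (≤-trans (minimal S r ∣S∣≡k r∈S m'' max'') m''≤)

∈-other : ∀ {n} (S : Subset n) (r : Fin n) → 2 ≤ ∣ S ∣ → ∃ λ s → s ∈ S × s ≢ r
∈-other S r 2≤∣S∣ with any? (λ s → (s ∈? S) ×-dec ¬? (s ≟ᶠ r))
... | yes other = other
... | no none = ⊥-elim (2≰1 (≤-trans 2≤∣S∣ (subst (∣ S ∣ ≤_) (∣⁅x⁆∣≡1 r) (p⊆q⇒∣p∣≤∣q∣ S⊆⁅r⁆))))
  where
  2≰1 : ¬ (2 ≤ 1)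
  2≰1 (s≤s ())
  S⊆⁅r⁆ : S ⊆ ⁅ r ⁆
  S⊆⁅r⁆ {s} s∈S with s ≟ᶠ r
  ... | yes s≡r = Equivalence.from x∈⁅y⁆⇔x≡y s≡r
  ... | no  s≢r = ⊥-elim (none (s , s∈S , s≢r))

UConn-arc : ∀ {n} {Ar : Arcs n} {x y} → UConn Ar x y → x ≢ y → ∃ λ a → ∃ λ b → Ar a b ≡ true
UConn-arc here              x≢y = ⊥-elim (x≢y refl)
UConn-arc (fwd {x} {y} p _) _   = x , y , p
UConn-arc (bwd {x} {y} p _) _   = y , x , p

IsMinMax-positive⇒arc : ∀ {n} (D : Digraph n) (R : Rel D) {k m} → 2 ≤ k → 1 ≤ m →
  IsMinMax D R k m → ∃ λ a → ∃ λ b → IsArc D a b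
IsMinMax-positive⇒arc D R {m = suc _} 2≤k _ ((S , r , ∣S∣≡k , r∈S , (T , trees , _) , _) , _)
  with ∈-other S r (subst (2 ≤_) (sym ∣S∣≡k) 2≤k) | trees fzero
... | s , s∈S , s≢r | (_ , (connected , _) , _) , S⊆V
  with UConn-arc (connected r s (S⊆V r∈S) (S⊆V s∈S)) (λ r≡s → s≢r (sym r≡s))
...   | a , b , ab∈T = a , b , A⊆D (T fzero) a b ab∈T

module Minimality {n} (D : Digraph n) (Q : Disjointness n) (Q⇒arcDisjoint : ImpliesArcDisjoint Q)
                  (k ℓ : ℕ) (2≤k : 2 ≤ k) (1≤ℓ : 1 ≤ ℓ) where

  open RemoveArc D using (D-e; IsMinMax-removeArc)

  MinMax : Digraph n → ℕ → Set
  MinMax H = IsMinMax H (onSub H Q) k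

  Minimal : Set
  Minimal = (∃ λ m → MinMax D m × ℓ ≤ m) ×
            (∀ u v → IsArc D u v → ∃ λ m → MinMax (D-e u v) m × m ≤ ℓ ∸ 1)

  Exact : Set
  Exact = MinMax D ℓ × (∀ u v → IsArc D u v → MinMax (D-e u v) (ℓ ∸ 1))

  suc-pred-ℓ : suc (ℓ ∸ 1) ≡ ℓ
  suc-pred-ℓ = m+[n∸m]≡n 1≤ℓ

  removeArc-≤ : ∀ {u v m m'} → MinMax D m → MinMax (D-e u v) m' → m' ≤ ℓ ∸ 1 → m ≤ ℓ
  removeArc-≤ {u} {v} {m} {m'} κD κD-e m'≤ =
    ≤-trans (IsMinMax-removeArc u v Q Q⇒arcDisjoint κD κD-e)
            (subst (suc m' ≤_) suc-pred-ℓ (s≤s m'≤))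

  minimal⇒exact : Minimal → Exact
  minimal⇒exact ((m , κD , ℓ≤m) , below) = subst (MinMax D) m≡ℓ κD , exact-D-e
    where
    m≡ℓ : m ≡ ℓ
    m≡ℓ with IsMinMax-positive⇒arc D (onSub D Q) 2≤k (≤-trans 1≤ℓ ℓ≤m) κD
    ... | u , v , uv with below u v uv
    ...   | _ , κD-e , m'≤ = ≤-antisym (removeArc-≤ κD κD-e m'≤) ℓ≤m

    exact-D-e : ∀ u v → IsArc D u v → MinMax (D-e u v) (ℓ ∸ 1)
    exact-D-e u v uv with below u v uv
    ... | m' , κD-e , m'≤ = subst (MinMax (D-e u v)) (≤-antisym m'≤ ℓ∸1≤m') κD-e
      where
      ℓ∸1≤m' : ℓ ∸ 1 ≤ m'
      ℓ∸1≤m' = ≤-pred (subst (_≤ suc m') (subst (m ≡_) (sym suc-pred-ℓ) m≡ℓ)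
                              (IsMinMax-removeArc u v Q Q⇒arcDisjoint κD κD-e))

  exact⇒minimal : Exact → Minimal
  exact⇒minimal (κD , κD-e) = (ℓ , κD , ≤-refl) , λ u v uv → ℓ ∸ 1 , κD-e u v uv , ≤-refl

  minimal⇔exact : Minimal ⇔ Exact
  minimal⇔exact = mk⇔ minimal⇒exact exact⇒minimal

proposition3p1 : ∀ {n : ℕ} (D : Digraph n) (k ℓ : ℕ) → 2 ≤ k → k ≤ n → 1 ≤ ℓ →
    (MinVertexStrong D k ℓ ⇔
      (KappaIs D k ℓ × (∀ (u v : Fin n) → IsArc D u v → KappaIs (D -arc (u , v)) k (ℓ ∸ 1))))
    ×
    (MinArcStrong D k ℓ ⇔
      (LambdaIs D k ℓ × (∀ (u v : Fin n) → IsArc D u v → LambdaIs (D -arc (u , v)) k (ℓ ∸ 1))))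
proposition3p1 D k ℓ 2≤k _ 1≤ℓ =
  Minimality.minimal⇔exact D internallyDisjoint proj₁ k ℓ 2≤k 1≤ℓ ,
  Minimality.minimal⇔exact D arcDisjoint (λ disjoint → disjoint) k ℓ 2≤k 1≤ℓ
  where
  -- onSub D of these unfolds to λ _ → ArcDisjoint resp. InternallyDisjoint.
  arcDisjoint internallyDisjoint : Disjointness _
  arcDisjoint S (_ , a) (_ , b) = ∀ x y → a x y ≡ true → b x y ≡ true → ⊥
  internallyDisjoint S (U , a) (W , b) =
    arcDisjoint S (U , a) (W , b) × (∀ x → x ∈ U → x ∈ W → x ∈ S)
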